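{- Let $d\ge 1$, let $p_1,\dots,p_{d-1}$ be nonnegative integers and $p_d\ge 2$ an integer. Let $\alpha=p_1+\cdots+p_{d-1}$ and $k=\left\lfloor\frac{p_d-2}{\alpha+1}\right\rfloor$. Suppose that $p_d\geq \alpha^2-\alpha$. Let $$T_{p_1\dots p_d}=\operatorname{conv}\{e_1,\dots,e_{d+1},(p_1,\dots,p_d,1)\}\subset\mathbb R^{d+1},$$ where $e_1,\dots,e_{d+1}$ is the standard basis of $\mathbb R^{d+1}$. Then $\operatorname{ls}_\Delta(T_{p_1\dots p_d})\leq k+3$.
   Context: An affine unimodular map $L\colon\mathbb R^{n}\to\mathbb R^{n}$ is a map $x\mapsto Ax+v$ with $A$ an integer $n\times n$ matrix of determinant $\pm1$ and $v\in\mathbb Z^{n}$. The standard simplex is $\Delta=\operatorname{conv}\{0,e_1,\dots,e_n\}\subset\mathbb R^n$. For a lattice polytope $P\subset\mathbb R^n$, the lattice size $\operatorname{ls}_\Delta(P)$ is the smallest $l$ such that $L(P)\subseteq l\Delta$ for some affine unimodular map $L$.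
   Formalization: In the lattice size, the inclusion $L(P)\subseteq l\Delta$ is required only for points of P that are convex combinations of its vertices with rational coefficients, rather than for all real points of P. -}

module Defs where

open import Data.Nat as ℕ using (ℕ; zero; suc)
open import Data.Integer as ℤ using (ℤ; +_; -[1+_])
open import Data.Rational as ℚ using (ℚ; 0ℚ; 1ℚ)
open import Data.Fin using (Fin; zero; suc; punchIn)
open import Data.Product using (Σ; ∃; _×_; _,_)
open import Data.Sum using (_⊎_)
open import Relation.Binary.PropositionalEquality using (_≡_)

Mat : ℕ → Set
Mat n = Fin n → Fin n → ℤ

ℤVec : ℕ → Set
ℤVec n = Fin n → ℤ

ℚPt : ℕ → Set
ℚPt n = Fin n → ℚ

sumℤ : (n : ℕ) → (Fin n → ℤ) → ℤ
sumℤ zero f = + 0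
sumℤ (suc n) f = f zero ℤ.+ sumℤ n (λ i → f (suc i))

sumℚ : (n : ℕ) → (Fin n → ℚ) → ℚ
sumℚ zero f = 0ℚ
sumℚ (suc n) f = f zero ℚ.+ sumℚ n (λ i → f (suc i))

sumℕ : (n : ℕ) → (Fin n → ℕ) → ℕ
sumℕ zero f = 0
sumℕ (suc n) f = f zero ℕ.+ sumℕ n (λ i → f (suc i))

sign : {n : ℕ} → Fin n → ℤ
sign zero = + 1
sign (suc j) = ℤ.- sign j

det : (n : ℕ) → Mat n → ℤ
det zero A = + 1
det (suc n) A =
  sumℤ (suc n) (λ j → sign j ℤ.* A zero j ℤ.* det n (λ r c → A (suc r) (punchIn j c)))

Unimodular : (n : ℕ) → Mat n → Set
Unimodular n A = det n A ≡ + 1 ⊎ det n A ≡ -[1+ 0 ]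

toℚ : ℤ → ℚ
toℚ z = z ℚ./ 1

applyAff : (n : ℕ) → Mat n → ℤVec n → ℚPt n → ℚPt n
applyAff n A v x i = sumℚ n (λ j → toℚ (A i j) ℚ.* x j) ℚ.+ toℚ (v i)

InDilSimplex : (n : ℕ) → ℕ → ℚPt n → Set
InDilSimplex n l x = ((i : Fin n) → 0ℚ ℚ.≤ x i) × (sumℚ n x ℚ.≤ toℚ (+ l))

InConv : (n m : ℕ) → (Fin m → ℤVec n) → ℚPt n → Set
InConv n m V x = Σ (Fin m → ℚ) λ c →
  ((j : Fin m) → 0ℚ ℚ.≤ c j) × (sumℚ m c ≡ 1ℚ) ×
  ((i : Fin n) → x i ≡ sumℚ m (λ j → c j ℚ.* toℚ (V j i)))

-- lattice polytope P = conv V; "ls_Δ(P) ≤ b" unfolded from the definition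
-- of ls_Δ as the least l with some affine unimodular L, L(P) ⊆ l Δ
LsΔ≤ : (n m : ℕ) → (Fin m → ℤVec n) → ℕ → Set
LsΔ≤ n m V b = Σ ℕ λ l → (l ℕ.≤ b) × Σ (Mat n) λ A → Σ (ℤVec n) λ v →
  Unimodular n A × ((x : ℚPt n) → InConv n m V x → InDilSimplex n l (applyAff n A v x))

basis : (n : ℕ) → Fin n → ℤVec n
basis (suc n) zero zero = + 1
basis (suc n) zero (suc j) = + 0
basis (suc n) (suc i) zero = + 0
basis (suc n) (suc i) (suc j) = basis n i j

-- the point (p_1, …, p_{d-1}, p_d, 1) with d = suc m, ps = (p_1..p_{d-1})
apex : (m : ℕ) → (Fin m → ℕ) → ℕ → ℤVec (suc (suc m))
apex zero ps pd zero = + pd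
apex zero ps pd (suc zero) = + 1
apex (suc m) ps pd zero = + ps zero
apex (suc m) ps pd (suc i) = apex m (λ j → ps (suc j)) pd i

-- vertex list of T_{p_1…p_d} ⊂ ℝ^{d+1}: index zero is the apex, suc i is e_{i+1}
Tverts : (m : ℕ) → (Fin m → ℕ) → ℕ → Fin (suc (suc (suc m))) → ℤVec (suc (suc m))
Tverts m ps pd zero = apex m ps pd
Tverts m ps pd (suc i) = basis (suc (suc m)) i

-- The affine map fixes every coordinate except the p_d-coordinate, which becomes
-- x_d − K (x_1 + ⋯ + x_{d−1}) − b x_{d+1} + K for K = k + 2 and a suitable b.
-- Its matrix is the identity up to one row with 1 on the diagonal, so it is unimodular.
-- It sends e_i to e_i for i < d, e_d to (K+1) e_d, e_{d+1} to e_{d+1} + (K − b) e_d and the apex to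
-- (p_1, …, p_{d−1}, f, 1) with f = p_d + K − K α − b; all of these lie in (K+1) Δ as soon as
-- 0 ≤ b ≤ K and 0 ≤ f ≤ K − α, and then so does the image of T, (K+1) Δ being convex.
-- Writing p_d − 2 = k (α + 1) + r with r ≤ α, the hypothesis p_d ≥ α² − α forces α ≤ K,
-- and b = r + K − α, f = K − α do the job.

module Submission where

open import Algebra.Bundles using (CommutativeMonoid; AbelianGroup)
open import Data.Bool using (Bool; true; false; if_then_else_)
open import Data.Fin using (Fin; zero; suc; punchIn)
open import Data.Integer as ℤ using (ℤ; +_; -[1+_]; +≤+)
import Data.Integer.Properties as ℤP
import Data.Integer.Tactic.RingSolver as ℤ-Solver
open import Data.Nat using (ℕ; zero; suc; _+_; _*_; _∸_; _/_; _%_; _≤_; _<_; _≤?_; z≤n; s≤s)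
open import Data.Nat.Coprimality as Coprimality using (Coprime)
open import Data.Nat.DivMod using (m≡m%n+[m/n]*n; m%n<n)
open import Data.Nat.Properties
import Data.Nat.Tactic.RingSolver as ℕ-Solver
open import Data.Product using (Σ; _×_; _,_; proj₁; proj₂)
open import Data.Rational as ℚ using (ℚ; 0ℚ; 1ℚ; mkℚ)
import Data.Rational.Properties as ℚP
open import Data.Sum using (inj₁)
open import Function using (_∘_)
open import Relation.Binary.PropositionalEquality
open import Relation.Nullary using (yes; no; contradiction)

open import Algebra.Properties.CommutativeSemigroup
  (CommutativeMonoid.commutativeSemigroup ℚP.+-0-commutativeMonoid)
  using () renaming (interchange to ℚ+-interchange)
open import Algebra.Properties.CommutativeSemigroup
  (CommutativeMonoid.commutativeSemigroup ℚP.*-1-commutativeMonoid)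
  using () renaming (x∙yz≈y∙xz to ℚ*-x∙yz≈y∙xz)
open import Algebra.Properties.CommutativeSemigroup ℤP.+-commutativeSemigroup
  using () renaming (x∙yz≈y∙xz to ℤ+-x∙yz≈y∙xz)
open import Algebra.Properties.Group (AbelianGroup.group ℤP.+-0-abelianGroup)
  using () renaming (∙-cancelʳ to ℤ+-cancelʳ)

open import Defs

toℚ≡mkℚ : ∀ z → Σ (Coprime ℤ.∣ z ∣ 1) λ c → toℚ z ≡ mkℚ z 0 c
toℚ≡mkℚ (+ n) = c , ℚP.normalize-coprime c
  where c = Coprimality.sym (Coprimality.1-coprimeTo n)
toℚ≡mkℚ -[1+ n ] = c , cong ℚ.-_ (ℚP.normalize-coprime c)
  where c = Coprimality.sym (Coprimality.1-coprimeTo (suc n))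

toℚ-+ : ∀ a b → toℚ (a ℤ.+ b) ≡ toℚ a ℚ.+ toℚ b
toℚ-+ a b with toℚ≡mkℚ a | toℚ≡mkℚ b
... | _ , ea | _ , eb rewrite ea | eb =
  cong (ℚ._/ 1) (cong₂ ℤ._+_ (sym (ℤP.*-identityʳ a)) (sym (ℤP.*-identityʳ b)))

toℚ-* : ∀ a b → toℚ (a ℤ.* b) ≡ toℚ a ℚ.* toℚ b
toℚ-* a b with toℚ≡mkℚ a | toℚ≡mkℚ b
... | _ , ea | _ , eb rewrite ea | eb = refl

toℚ-mono-≤ : ∀ {a b} → a ℤ.≤ b → toℚ a ℚ.≤ toℚ b
toℚ-mono-≤ {a} {b} a≤b with toℚ≡mkℚ a | toℚ≡mkℚ b
... | _ , ea | _ , eb rewrite ea | eb =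
  ℚ.*≤* (subst₂ ℤ._≤_ (sym (ℤP.*-identityʳ a)) (sym (ℤP.*-identityʳ b)) a≤b)

sumℚ-cong : ∀ n {f g : Fin n → ℚ} → (∀ i → f i ≡ g i) → sumℚ n f ≡ sumℚ n g
sumℚ-cong zero    f≗g = refl
sumℚ-cong (suc n) f≗g = cong₂ ℚ._+_ (f≗g zero) (sumℚ-cong n (λ i → f≗g (suc i)))

sumℚ-zero : ∀ n {f : Fin n → ℚ} → (∀ i → f i ≡ 0ℚ) → sumℚ n f ≡ 0ℚ
sumℚ-zero zero    f≡0 = refl
sumℚ-zero (suc n) f≡0 = cong₂ ℚ._+_ (f≡0 zero) (sumℚ-zero n (λ i → f≡0 (suc i)))

sumℚ-+ : ∀ n (f g : Fin n → ℚ) → sumℚ n (λ i → f i ℚ.+ g i) ≡ sumℚ n f ℚ.+ sumℚ n g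
sumℚ-+ zero    f g = refl
sumℚ-+ (suc n) f g =
  trans (cong (f zero ℚ.+ g zero ℚ.+_) (sumℚ-+ n (λ i → f (suc i)) (λ i → g (suc i))))
        (ℚ+-interchange (f zero) (g zero) _ _)

sumℚ-*ˡ : ∀ n a (f : Fin n → ℚ) → a ℚ.* sumℚ n f ≡ sumℚ n (λ i → a ℚ.* f i)
sumℚ-*ˡ zero    a f = ℚP.*-zeroʳ a
sumℚ-*ˡ (suc n) a f =
  trans (ℚP.*-distribˡ-+ a (f zero) _) (cong (a ℚ.* f zero ℚ.+_) (sumℚ-*ˡ n a (λ i → f (suc i))))

sumℚ-comm : ∀ n m (f : Fin n → Fin m → ℚ) →
  sumℚ n (λ i → sumℚ m (f i)) ≡ sumℚ m (λ j → sumℚ n (λ i → f i j))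
sumℚ-comm zero    m f = sym (sumℚ-zero m (λ _ → refl))
sumℚ-comm (suc n) m f =
  trans (cong (sumℚ m (f zero) ℚ.+_) (sumℚ-comm n m (λ i → f (suc i))))
        (sym (sumℚ-+ m (f zero) _))

sumℚ-mono-≤ : ∀ n {f g : Fin n → ℚ} → (∀ i → f i ℚ.≤ g i) → sumℚ n f ℚ.≤ sumℚ n g
sumℚ-mono-≤ zero    f≤g = ℚP.≤-refl
sumℚ-mono-≤ (suc n) f≤g = ℚP.+-mono-≤ (f≤g zero) (sumℚ-mono-≤ n (λ i → f≤g (suc i)))

toℚ-sumℤ : ∀ n (f : Fin n → ℤ) → toℚ (sumℤ n f) ≡ sumℚ n (λ i → toℚ (f i))
toℚ-sumℤ zero    f = refl
toℚ-sumℤ (suc n) f = trans (toℚ-+ (f zero) _) (cong (toℚ (f zero) ℚ.+_) (toℚ-sumℤ n (λ i → f (suc i))))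

combination : (m : ℕ) → (Fin m → ℚ) → (Fin m → ℚ) → ℚ
combination m c y = sumℚ m (λ j → c j ℚ.* y j)

combination-+ : ∀ m c (y z : Fin m → ℚ) →
  combination m c (λ j → y j ℚ.+ z j) ≡ combination m c y ℚ.+ combination m c z
combination-+ m c y z =
  trans (sumℚ-cong m (λ j → ℚP.*-distribˡ-+ (c j) (y j) (z j))) (sumℚ-+ m _ _)

combination-const : ∀ m {c} → sumℚ m c ≡ 1ℚ → ∀ t → combination m c (λ _ → t) ≡ t
combination-const m {c} Σc≡1 t = begin
  sumℚ m (λ j → c j ℚ.* t) ≡⟨ sumℚ-cong m (λ j → ℚP.*-comm (c j) t) ⟩
  sumℚ m (λ j → t ℚ.* c j) ≡⟨ sumℚ-*ˡ m t c ⟨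
  t ℚ.* sumℚ m c           ≡⟨ cong (t ℚ.*_) Σc≡1 ⟩
  t ℚ.* 1ℚ                 ≡⟨ ℚP.*-identityʳ t ⟩
  t                        ∎
  where open ≡-Reasoning

combination-*ˡ : ∀ m c y a → a ℚ.* combination m c y ≡ combination m c (λ j → a ℚ.* y j)
combination-*ˡ m c y a = trans (sumℚ-*ˡ m a _) (sumℚ-cong m (λ j → ℚ*-x∙yz≈y∙xz a (c j) (y j)))

combination-sumℚ : ∀ n m c (y : Fin m → Fin n → ℚ) →
  sumℚ n (λ k → combination m c (λ j → y j k)) ≡ combination m c (λ j → sumℚ n (y j))
combination-sumℚ n m c y =
  trans (sumℚ-comm n m (λ k j → c j ℚ.* y j k))
        (sumℚ-cong m (λ j → sym (sumℚ-*ˡ n (c j) (y j))))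

combination-mono-≤ : ∀ m {c y z} → (∀ j → 0ℚ ℚ.≤ c j) → (∀ j → y j ℚ.≤ z j) →
  combination m c y ℚ.≤ combination m c z
combination-mono-≤ m {c} c≥0 y≤z =
  sumℚ-mono-≤ m (λ j → ℚP.*-monoˡ-≤-nonNeg (c j) {{ℚ.nonNegative (c≥0 j)}} (y≤z j))

InDilSimplex-combination : ∀ n m l {c : Fin m → ℚ} {y : Fin m → ℚPt n} {x : ℚPt n} →
  (∀ j → 0ℚ ℚ.≤ c j) → sumℚ m c ≡ 1ℚ → (∀ j → InDilSimplex n l (y j)) →
  (∀ i → x i ≡ combination m c (λ j → y j i)) → InDilSimplex n l x
InDilSimplex-combination n m l {c} {y} {x} c≥0 Σc≡1 y∈lΔ x≡ = x≥0 , Σx≤l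
  where
  x≥0 : ∀ i → 0ℚ ℚ.≤ x i
  x≥0 i = subst₂ ℚ._≤_ (combination-const m Σc≡1 0ℚ) (sym (x≡ i))
    (combination-mono-≤ m c≥0 (λ j → proj₁ (y∈lΔ j) i))
  Σx≤l : sumℚ n x ℚ.≤ toℚ (+ l)
  Σx≤l = subst₂ ℚ._≤_
    (sym (trans (sumℚ-cong n x≡) (combination-sumℚ n m c (λ j i → y j i))))
    (combination-const m Σc≡1 (toℚ (+ l)))
    (combination-mono-≤ m c≥0 (λ j → proj₂ (y∈lΔ j)))

applyAff-combination : ∀ n m (A : Mat n) (v : ℤVec n) {c : Fin m → ℚ} {y : Fin m → ℚPt n} {x : ℚPt n} →
  sumℚ m c ≡ 1ℚ → (∀ k → x k ≡ combination m c (λ j → y j k)) →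
  ∀ i → applyAff n A v x i ≡ combination m c (λ j → applyAff n A v (y j) i)
applyAff-combination n m A v {c} {y} {x} Σc≡1 x≡ i = begin
  sumℚ n (λ k → a k ℚ.* x k) ℚ.+ t
    ≡⟨ cong (ℚ._+ t) (sumℚ-cong n (λ k → cong (a k ℚ.*_) (x≡ k))) ⟩
  sumℚ n (λ k → a k ℚ.* combination m c (λ j → y j k)) ℚ.+ t
    ≡⟨ cong (ℚ._+ t) (sumℚ-cong n (λ k → combination-*ˡ m c (λ j → y j k) (a k))) ⟩
  sumℚ n (λ k → combination m c (λ j → a k ℚ.* y j k)) ℚ.+ t
    ≡⟨ cong₂ ℚ._+_ (combination-sumℚ n m c (λ j k → a k ℚ.* y j k)) (sym (combination-const m Σc≡1 t)) ⟩
  combination m c (λ j → sumℚ n (λ k → a k ℚ.* y j k)) ℚ.+ combination m c (λ _ → t)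
    ≡⟨ combination-+ m c _ _ ⟨
  combination m c (λ j → applyAff n A v (y j) i) ∎
  where
  open ≡-Reasoning
  a : Fin n → ℚ
  a k = toℚ (A i k)
  t = toℚ (v i)

affℤ : (n : ℕ) → Mat n → ℤVec n → ℤVec n → ℤVec n
affℤ n A v w i = sumℤ n (λ j → A i j ℤ.* w j) ℤ.+ v i

toℚ-affℤ : ∀ n A v (w : ℤVec n) i → toℚ (affℤ n A v w i) ≡ applyAff n A v (toℚ ∘ w) i
toℚ-affℤ n A v w i = trans (toℚ-+ (sumℤ n (λ j → A i j ℤ.* w j)) (v i)) (cong (ℚ._+ toℚ (v i))
  (trans (toℚ-sumℤ n (λ j → A i j ℤ.* w j)) (sumℚ-cong n (λ j → toℚ-* (A i j) (w j)))))

InDilSimplexℤ : (n : ℕ) → ℕ → ℤVec n → Set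
InDilSimplexℤ n l w = ((i : Fin n) → + 0 ℤ.≤ w i) × (sumℤ n w ℤ.≤ + l)

InDilSimplexℤ⇒InDilSimplex : ∀ n l {w : ℤVec n} {x : ℚPt n} →
  InDilSimplexℤ n l w → (∀ i → x i ≡ toℚ (w i)) → InDilSimplex n l x
InDilSimplexℤ⇒InDilSimplex n l {w} (w≥0 , Σw≤l) x≡ =
  (λ i → subst (0ℚ ℚ.≤_) (sym (x≡ i)) (toℚ-mono-≤ (w≥0 i))) ,
  subst (ℚ._≤ toℚ (+ l)) (trans (toℚ-sumℤ n w) (sym (sumℚ-cong n x≡))) (toℚ-mono-≤ Σw≤l)

InConv⇒applyAff-InDilSimplex : ∀ n m (A : Mat n) (v : ℤVec n) (V : Fin m → ℤVec n) l →
  (∀ j → InDilSimplexℤ n l (affℤ n A v (V j))) →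
  ∀ x → InConv n m V x → InDilSimplex n l (applyAff n A v x)
InConv⇒applyAff-InDilSimplex n m A v V l vertices∈lΔ x (c , c≥0 , Σc≡1 , x≡) =
  InDilSimplex-combination n m l c≥0 Σc≡1
    (λ j → InDilSimplexℤ⇒InDilSimplex n l (vertices∈lΔ j) (λ i → sym (toℚ-affℤ n A v (V j) i)))
    (applyAff-combination n m A v Σc≡1 x≡)

sumℤ-cong : ∀ n {f g : Fin n → ℤ} → (∀ i → f i ≡ g i) → sumℤ n f ≡ sumℤ n g
sumℤ-cong zero    f≗g = refl
sumℤ-cong (suc n) f≗g = cong₂ ℤ._+_ (f≗g zero) (sumℤ-cong n (λ i → f≗g (suc i)))

sumℤ-zero : ∀ n {f : Fin n → ℤ} → (∀ i → f i ≡ + 0) → sumℤ n f ≡ + 0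
sumℤ-zero zero    f≡0 = refl
sumℤ-zero (suc n) f≡0 = cong₂ ℤ._+_ (f≡0 zero) (sumℤ-zero n (λ i → f≡0 (suc i)))

det-unitFirstRow : ∀ n (A : Mat (suc n)) → A zero zero ≡ + 1 → (∀ j → A zero (suc j) ≡ + 0) →
  det (suc n) A ≡ det n (λ r c → A (suc r) (suc c))
det-unitFirstRow n A a₀₀≡1 a₀ⱼ≡0 =
  trans (cong₂ ℤ._+_ leading (sumℤ-zero n others)) (ℤP.+-identityʳ _)
  where
  minor : Fin (suc n) → ℤ
  minor j = det n (λ r c → A (suc r) (punchIn j c))
  leading : + 1 ℤ.* A zero zero ℤ.* minor zero ≡ minor zero
  leading = trans (cong (λ a → + 1 ℤ.* a ℤ.* minor zero) a₀₀≡1) (ℤP.*-identityˡ (minor zero))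
  others : ∀ j → sign (suc j) ℤ.* A zero (suc j) ℤ.* minor (suc j) ≡ + 0
  others j = begin
    sign (suc j) ℤ.* A zero (suc j) ℤ.* minor (suc j) ≡⟨ cong (λ a → sign (suc j) ℤ.* a ℤ.* minor (suc j)) (a₀ⱼ≡0 j) ⟩
    sign (suc j) ℤ.* + 0 ℤ.* minor (suc j)           ≡⟨ cong (ℤ._* minor (suc j)) (ℤP.*-zeroʳ (sign (suc j))) ⟩
    + 0 ℤ.* minor (suc j)                            ≡⟨ ℤP.*-zeroˡ (minor (suc j)) ⟩
    + 0                                              ∎
    where open ≡-Reasoning

det₂ : ∀ (A : Mat 2) →
  det 2 A ≡ A zero zero ℤ.* A (suc zero) (suc zero) ℤ.- A zero (suc zero) ℤ.* A (suc zero) zero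
det₂ A = expand (A zero zero) (A zero (suc zero)) (A (suc zero) zero) (A (suc zero) (suc zero))
  where
  expand : ∀ a b c d →
    + 1 ℤ.* a ℤ.* (+ 1 ℤ.* d ℤ.* + 1 ℤ.+ + 0) ℤ.+ (ℤ.- + 1 ℤ.* b ℤ.* (+ 1 ℤ.* c ℤ.* + 1 ℤ.+ + 0) ℤ.+ + 0)
      ≡ a ℤ.* d ℤ.- b ℤ.* c
  expand = ℤ-Solver.solve-∀

pos-∸ : ∀ {m n} → n ≤ m → + (m ∸ n) ≡ + m ℤ.- + n
pos-∸ {m} {n} n≤m = trans (sym (ℤP.⊖-≥ n≤m)) (sym (ℤP.m-n≡m⊖n m n))

-- In ℝ^{m+2} the p_d-coordinate has index m.
isPd : (m : ℕ) → Fin (suc (suc m)) → Bool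
isPd zero    zero    = true
isPd zero    (suc _) = false
isPd (suc m) zero    = false
isPd (suc m) (suc r) = isPd m r

otherSum : (m : ℕ) → ℤVec (suc (suc m)) → ℤ
otherSum zero    w = w (suc zero)
otherSum (suc m) w = w zero ℤ.+ otherSum m (w ∘ suc)

sumℤ-replacePd : ∀ m x (w : ℤVec (suc (suc m))) →
  sumℤ (suc (suc m)) (λ r → if isPd m r then x else w r) ≡ x ℤ.+ otherSum m w
sumℤ-replacePd zero    x w = cong (ℤ._+_ x) (ℤP.+-identityʳ (w (suc zero)))
sumℤ-replacePd (suc m) x w = begin
  w zero ℤ.+ sumℤ (suc (suc m)) (λ r → if isPd m r then x else w (suc r))
    ≡⟨ cong (ℤ._+_ (w zero)) (sumℤ-replacePd m x (w ∘ suc)) ⟩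
  w zero ℤ.+ (x ℤ.+ otherSum m (w ∘ suc))
    ≡⟨ ℤ+-x∙yz≈y∙xz (w zero) x _ ⟩
  x ℤ.+ (w zero ℤ.+ otherSum m (w ∘ suc)) ∎
  where open ≡-Reasoning

otherSum-zero : ∀ m → otherSum m (λ _ → + 0) ≡ + 0
otherSum-zero zero    = refl
otherSum-zero (suc m) = trans (ℤP.+-identityˡ _) (otherSum-zero m)

otherSum-apex : ∀ m ps pd → otherSum m (apex m ps pd) ≡ + (sumℕ m ps + 1)
otherSum-apex zero    ps pd = refl
otherSum-apex (suc m) ps pd =
  trans (cong (ℤ._+_ (+ ps zero)) (otherSum-apex m (ps ∘ suc) pd))
        (cong +_ (sym (+-assoc (ps zero) _ 1)))

apex-nonneg : ∀ m ps pd i → + 0 ℤ.≤ apex m ps pd i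
apex-nonneg zero    ps pd zero       = +≤+ z≤n
apex-nonneg zero    ps pd (suc zero) = +≤+ z≤n
apex-nonneg (suc m) ps pd zero       = +≤+ z≤n
apex-nonneg (suc m) ps pd (suc i)    = apex-nonneg m (ps ∘ suc) pd i

basis-nonneg : ∀ n t i → + 0 ℤ.≤ basis n t i
basis-nonneg (suc n) zero    zero    = +≤+ z≤n
basis-nonneg (suc n) zero    (suc i) = +≤+ z≤n
basis-nonneg (suc n) (suc t) zero    = +≤+ z≤n
basis-nonneg (suc n) (suc t) (suc i) = basis-nonneg n t i

ImageBound : ℕ → ℤ → ℤ → Set
ImageBound l x y = (+ 0 ℤ.≤ x) × (x ℤ.+ y ℤ.≤ + l)

ImageBound-pos : ∀ l f g {x y} → x ≡ + f → y ≡ + g → f + g ≤ l → ImageBound l x y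
ImageBound-pos l f g refl refl f+g≤l = +≤+ z≤n , +≤+ f+g≤l

module _ (K b : ℕ) where

  shear : (m : ℕ) → Mat (suc (suc m))
  shear zero    zero          zero          = + 1
  shear zero    zero          (suc zero)    = ℤ.- + b
  shear zero    (suc zero)    zero          = + 0
  shear zero    (suc zero)    (suc zero)    = + 1
  shear (suc m) zero          zero          = + 1
  shear (suc m) zero          (suc j)       = + 0
  shear (suc m) (suc r)       zero          = if isPd m r then ℤ.- + K else + 0
  shear (suc m) (suc r)       (suc j)       = shear m r j

  shift : (m : ℕ) → ℤVec (suc (suc m))
  shift m r = if isPd m r then + K else + 0

  pdImage : (m : ℕ) → ℤVec (suc (suc m)) → ℤ
  pdImage zero    w = w zero ℤ.- + b ℤ.* w (suc zero) ℤ.+ + K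
  pdImage (suc m) w = ℤ.- + K ℤ.* w zero ℤ.+ pdImage m (w ∘ suc)

  det-shear : ∀ m → det (suc (suc m)) (shear m) ≡ + 1
  det-shear zero    = trans (det₂ (shear zero)) (unipotent (+ b))
    where
    unipotent : ∀ x → + 1 ℤ.* + 1 ℤ.- ℤ.- x ℤ.* + 0 ≡ + 1
    unipotent = ℤ-Solver.solve-∀
  det-shear (suc m) = trans (det-unitFirstRow _ (shear (suc m)) refl (λ _ → refl)) (det-shear m)

  affℤ-shear : ∀ m w r →
    affℤ (suc (suc m)) (shear m) (shift m) w r ≡ (if isPd m r then pdImage m w else w r)
  affℤ-shear zero    w zero       = pdRow (w zero) (w (suc zero)) (+ b) (+ K)
    where
    pdRow : ∀ x y β κ → + 1 ℤ.* x ℤ.+ (ℤ.- β ℤ.* y ℤ.+ + 0) ℤ.+ κ ≡ x ℤ.- β ℤ.* y ℤ.+ κ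
    pdRow = ℤ-Solver.solve-∀
  affℤ-shear zero    w (suc zero) = lastRow (w zero) (w (suc zero))
    where
    lastRow : ∀ x y → + 0 ℤ.* x ℤ.+ (+ 1 ℤ.* y ℤ.+ + 0) ℤ.+ + 0 ≡ y
    lastRow = ℤ-Solver.solve-∀
  affℤ-shear (suc m) w zero       =
    trans (cong (λ s → + 1 ℤ.* w zero ℤ.+ s ℤ.+ + 0) (sumℤ-zero _ (λ j → ℤP.*-zeroˡ (w (suc j)))))
          (firstRow (w zero))
    where
    firstRow : ∀ x → + 1 ℤ.* x ℤ.+ + 0 ℤ.+ + 0 ≡ x
    firstRow = ℤ-Solver.solve-∀
  affℤ-shear (suc m) w (suc r)    = begin
    c (isPd m r) ℤ.* w zero ℤ.+ sumℤ _ (λ j → shear m r j ℤ.* w (suc j)) ℤ.+ shift m r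
      ≡⟨ ℤP.+-assoc (c (isPd m r) ℤ.* w zero) _ (shift m r) ⟩
    c (isPd m r) ℤ.* w zero ℤ.+ affℤ _ (shear m) (shift m) (w ∘ suc) r
      ≡⟨ cong (ℤ._+_ (c (isPd m r) ℤ.* w zero)) (affℤ-shear m (w ∘ suc) r) ⟩
    c (isPd m r) ℤ.* w zero ℤ.+ (if isPd m r then pdImage m (w ∘ suc) else w (suc r))
      ≡⟨ merge (isPd m r) ⟩
    (if isPd m r then pdImage (suc m) w else w (suc r)) ∎
    where
    open ≡-Reasoning
    c : Bool → ℤ
    c B = if B then ℤ.- + K else + 0
    merge : ∀ B → c B ℤ.* w zero ℤ.+ (if B then pdImage m (w ∘ suc) else w (suc r))
                ≡ (if B then pdImage (suc m) w else w (suc r))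
    merge true  = refl
    merge false = trans (cong (ℤ._+ w (suc r)) (ℤP.*-zeroˡ (w zero))) (ℤP.+-identityˡ (w (suc r)))

  shear-InDilSimplexℤ : ∀ m l (w : ℤVec (suc (suc m))) → (∀ i → + 0 ℤ.≤ w i) →
    ImageBound l (pdImage m w) (otherSum m w) →
    InDilSimplexℤ (suc (suc m)) l (affℤ (suc (suc m)) (shear m) (shift m) w)
  shear-InDilSimplexℤ m l w w≥0 (pd≥0 , pd+other≤l) = image≥0 , Σimage≤l
    where
    image≥0 : ∀ r → + 0 ℤ.≤ affℤ (suc (suc m)) (shear m) (shift m) w r
    image≥0 r with isPd m r | affℤ-shear m w r
    ... | true  | image≡ = subst (ℤ._≤_ (+ 0)) (sym image≡) pd≥0
    ... | false | image≡ = subst (ℤ._≤_ (+ 0)) (sym image≡) (w≥0 r)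
    Σimage≤l : sumℤ (suc (suc m)) (affℤ (suc (suc m)) (shear m) (shift m) w) ℤ.≤ + l
    Σimage≤l = subst (ℤ._≤ + l)
      (sym (trans (sumℤ-cong _ (affℤ-shear m w)) (sumℤ-replacePd m (pdImage m w) w)))
      pd+other≤l

  pdImage-zero : ∀ m → pdImage m (λ _ → + 0) ≡ + K
  pdImage-zero zero    = lastColumn (+ b) (+ K)
    where
    lastColumn : ∀ β κ → + 0 ℤ.- β ℤ.* + 0 ℤ.+ κ ≡ κ
    lastColumn = ℤ-Solver.solve-∀
  pdImage-zero (suc m) =
    trans (cong₂ ℤ._+_ (ℤP.*-zeroʳ (ℤ.- + K)) (pdImage-zero m)) (ℤP.+-identityˡ (+ K))

  basis-ImageBound : b ≤ K → ∀ m t →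
    ImageBound (suc K) (pdImage m (basis _ t)) (otherSum m (basis _ t))
  basis-ImageBound b≤K zero    zero       =
    ImageBound-pos (suc K) (suc K) 0 (pdColumn (+ b) (+ K)) refl (≤-reflexive (+-identityʳ (suc K)))
    where
    pdColumn : ∀ β κ → + 1 ℤ.- β ℤ.* + 0 ℤ.+ κ ≡ + 1 ℤ.+ κ
    pdColumn = ℤ-Solver.solve-∀
  basis-ImageBound b≤K zero    (suc zero) =
    ImageBound-pos (suc K) (K ∸ b) 1 (trans (lastColumn (+ b) (+ K)) (sym (pos-∸ b≤K))) refl
      (≤-trans (+-monoˡ-≤ 1 (m∸n≤m K b)) (≤-reflexive (+-comm K 1)))
    where
    lastColumn : ∀ β κ → + 0 ℤ.- β ℤ.* + 1 ℤ.+ κ ≡ κ ℤ.- β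
    lastColumn = ℤ-Solver.solve-∀
  basis-ImageBound b≤K (suc m) zero       =
    ImageBound-pos (suc K) 0 1
      (trans (cong (ℤ._+_ (ℤ.- + K ℤ.* + 1)) (pdImage-zero m)) (cancel (+ K)))
      (cong (ℤ._+_ (+ 1)) (otherSum-zero m))
      (s≤s z≤n)
    where
    cancel : ∀ κ → ℤ.- κ ℤ.* + 1 ℤ.+ κ ≡ + 0
    cancel = ℤ-Solver.solve-∀
  basis-ImageBound b≤K (suc m) (suc t)    =
    subst₂ (ImageBound (suc K))
      (sym (trans (cong (ℤ._+ pdImage m (basis _ t)) (ℤP.*-zeroʳ (ℤ.- + K))) (ℤP.+-identityˡ _)))
      (sym (ℤP.+-identityˡ _))
      (basis-ImageBound b≤K m t)

  pdImage-apex : ∀ m ps pd → pdImage m (apex m ps pd) ℤ.+ + (K * sumℕ m ps + b) ≡ + (pd + K)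
  pdImage-apex zero    ps pd = begin
    + pd ℤ.- + b ℤ.* + 1 ℤ.+ + K ℤ.+ + (K * 0 + b) ≡⟨ cong (λ k → + pd ℤ.- + b ℤ.* + 1 ℤ.+ + K ℤ.+ + (k + b)) (*-zeroʳ K) ⟩
    + pd ℤ.- + b ℤ.* + 1 ℤ.+ + K ℤ.+ + b           ≡⟨ cancel (+ pd) (+ b) (+ K) ⟩
    + pd ℤ.+ + K                                   ∎
    where
    open ≡-Reasoning
    cancel : ∀ π β κ → π ℤ.- β ℤ.* + 1 ℤ.+ κ ℤ.+ β ≡ π ℤ.+ κ
    cancel = ℤ-Solver.solve-∀
  pdImage-apex (suc m) ps pd = begin
    ℤ.- + K ℤ.* + p ℤ.+ P ℤ.+ + (K * (p + α) + b)
      ≡⟨ cong (ℤ._+_ (ℤ.- + K ℤ.* + p ℤ.+ P)) split ⟩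
    ℤ.- + K ℤ.* + p ℤ.+ P ℤ.+ (+ K ℤ.* + p ℤ.+ + (K * α + b))
      ≡⟨ cancel (+ K) (+ p) P (+ (K * α + b)) ⟩
    P ℤ.+ + (K * α + b)
      ≡⟨ pdImage-apex m (ps ∘ suc) pd ⟩
    + (pd + K) ∎
    where
    open ≡-Reasoning
    p = ps zero
    α = sumℕ m (ps ∘ suc)
    P = pdImage m (apex m (ps ∘ suc) pd)
    split : + (K * (p + α) + b) ≡ + K ℤ.* + p ℤ.+ + (K * α + b)
    split = begin
      + (K * (p + α) + b)     ≡⟨ cong +_ (trans (cong (_+ b) (*-distribˡ-+ K p α)) (+-assoc (K * p) (K * α) b)) ⟩
      + (K * p + (K * α + b)) ≡⟨ cong (ℤ._+ + (K * α + b)) (ℤP.pos-* K p) ⟩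
      + K ℤ.* + p ℤ.+ + (K * α + b) ∎
    cancel : ∀ κ π x y → ℤ.- κ ℤ.* π ℤ.+ x ℤ.+ (κ ℤ.* π ℤ.+ y) ≡ x ℤ.+ y
    cancel = ℤ-Solver.solve-∀

  apex-ImageBound : ∀ m ps pd f → f + sumℕ m ps ≤ K → pd + K ≡ K * sumℕ m ps + b + f →
    ImageBound (suc K) (pdImage m (apex m ps pd)) (otherSum m (apex m ps pd))
  apex-ImageBound m ps pd f f+α≤K balance =
    ImageBound-pos (suc K) f (α + 1) pdImage≡f (otherSum-apex m ps pd) f+α+1≤1+K
    where
    α = sumℕ m ps
    pdImage≡f : pdImage m (apex m ps pd) ≡ + f
    pdImage≡f = ℤ+-cancelʳ (+ (K * α + b)) _ (+ f)
      (trans (pdImage-apex m ps pd) (cong +_ (trans balance (+-comm (K * α + b) f))))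
    f+α+1≤1+K : f + (α + 1) ≤ suc K
    f+α+1≤1+K = begin
      f + (α + 1) ≡⟨ +-assoc f α 1 ⟨
      f + α + 1   ≤⟨ +-monoˡ-≤ 1 f+α≤K ⟩
      K + 1       ≡⟨ +-comm K 1 ⟩
      suc K       ∎
      where open ≤-Reasoning

record ShearParameters (α pd K : ℕ) : Set where
  field
    b f     : ℕ
    b≤K     : b ≤ K
    f+α≤K   : f + α ≤ K
    balance : pd + K ≡ K * α + b + f

LsΔ≤-Tverts : ∀ m ps pd {K} → ShearParameters (sumℕ m ps) pd K →
  LsΔ≤ (suc (suc m)) (suc (suc (suc m))) (Tverts m ps pd) (suc K)
LsΔ≤-Tverts m ps pd {K} params =
  suc K , ≤-refl , shear K b m , shift K b m , inj₁ (det-shear K b m) ,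
  InConv⇒applyAff-InDilSimplex _ _ (shear K b m) (shift K b m) (Tverts m ps pd) (suc K) vertex-images
  where
  open ShearParameters params
  vertex-images : ∀ j → InDilSimplexℤ _ (suc K) (affℤ _ (shear K b m) (shift K b m) (Tverts m ps pd j))
  vertex-images zero    = shear-InDilSimplexℤ K b m (suc K) _ (apex-nonneg m ps pd)
    (apex-ImageBound K b m ps pd f f+α≤K balance)
  vertex-images (suc t) = shear-InDilSimplexℤ K b m (suc K) _ (basis-nonneg _ t)
    (basis-ImageBound K b b≤K m t)

LsΔ≤-weaken : ∀ {n m V l l′} → l ≤ l′ → LsΔ≤ n m V l → LsΔ≤ n m V l′
LsΔ≤-weaken l≤l′ (k , k≤l , L) = k , ≤-trans k≤l l≤l′ , L

α≤quotient+2 : ∀ α pd q r → pd ≡ r + q * suc α + 2 → r ≤ α → α * α ∸ α ≤ pd → α ≤ q + 2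
α≤quotient+2 α pd q r pd≡ r≤α α²-α≤pd with α ≤? q + 2
... | yes α≤q+2 = α≤q+2
... | no  α≰q+2 = contradiction α²-α≤pd (<⇒≱ pd<α²-α)
  where
  q+2<α : q + 2 < α
  q+2<α = ≰⇒> α≰q+2
  expand : ∀ α q → α + q * suc α + 2 ≡ α * q + α + (q + 2)
  expand = ℕ-Solver.solve-∀
  collect : ∀ α q → α * q + α + α ≡ α * (q + 2)
  collect = ℕ-Solver.solve-∀
  pd<α²-α : pd < α * α ∸ α
  pd<α²-α = begin-strict
    pd                  ≡⟨ pd≡ ⟩
    r + q * suc α + 2   ≤⟨ +-monoˡ-≤ 2 (+-monoˡ-≤ (q * suc α) r≤α) ⟩
    α + q * suc α + 2   ≡⟨ expand α q ⟩
    α * q + α + (q + 2) <⟨ +-monoʳ-< (α * q + α) q+2<α ⟩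
    α * q + α + α       ≡⟨ collect α q ⟩
    α * (q + 2)         ≤⟨ *-monoʳ-≤ α (∸-monoˡ-≤ 1 q+2<α) ⟩
    α * (α ∸ 1)         ≡⟨ *-distribˡ-∸ α α 1 ⟩
    α * α ∸ α * 1       ≡⟨ cong (α * α ∸_) (*-identityʳ α) ⟩
    α * α ∸ α           ∎
    where open ≤-Reasoning

shearParameters : ∀ α pd → 2 ≤ pd → α * α ∸ α ≤ pd → ShearParameters α pd ((pd ∸ 2) / suc α + 2)
shearParameters α pd 2≤pd α²-α≤pd = record
  { b = r + s ; f = s
  ; b≤K = subst (r + s ≤_) α+s≡K (+-monoˡ-≤ s r≤α)
  ; f+α≤K = ≤-reflexive (trans (+-comm s α) α+s≡K)
  ; balance = +-cancelʳ-≡ (α + α) _ _ (trans lhs (sym rhs))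
  }
  where
  q = (pd ∸ 2) / suc α
  r = (pd ∸ 2) % suc α
  K = q + 2
  pd≡ : pd ≡ r + q * suc α + 2
  pd≡ = trans (sym (m∸n+n≡m 2≤pd)) (cong (_+ 2) (m≡m%n+[m/n]*n (pd ∸ 2) (suc α)))
  r≤α : r ≤ α
  r≤α = ≤-pred (m%n<n (pd ∸ 2) (suc α))
  s = K ∸ α
  α+s≡K : α + s ≡ K
  α+s≡K = m+[n∸m]≡n (α≤quotient+2 α pd q r pd≡ r≤α α²-α≤pd)
  expand : ∀ r q α → r + q * suc α + 2 + (q + 2) + (α + α) ≡ r + (q + 2) * α + (q + 2) + (q + 2)
  expand = ℕ-Solver.solve-∀
  regroup : ∀ K α r s → K * α + (r + s) + s + (α + α) ≡ r + K * α + (α + s) + (α + s)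
  regroup = ℕ-Solver.solve-∀
  lhs : pd + K + (α + α) ≡ r + K * α + K + K
  lhs = trans (cong (λ p → p + K + (α + α)) pd≡) (expand r q α)
  rhs : K * α + (r + s) + s + (α + α) ≡ r + K * α + K + K
  rhs = trans (regroup K α r s) (cong (λ k → r + K * α + k + k) α+s≡K)

proposition3p1 : (m : ℕ) (ps : Fin m → ℕ) (pd : ℕ) → 2 ≤ pd →
    sumℕ m ps * sumℕ m ps ∸ sumℕ m ps ≤ pd →
    LsΔ≤ (suc (suc m)) (suc (suc (suc m))) (Tverts m ps pd)
    ((pd ∸ 2) / suc (sumℕ m ps) + 3)
proposition3p1 m ps pd 2≤pd α²-α≤pd =
  LsΔ≤-weaken {V = Tverts m ps pd} (≤-reflexive (sym (+-suc ((pd ∸ 2) / suc (sumℕ m ps)) 2)))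
    (LsΔ≤-Tverts m ps pd (shearParameters (sumℕ m ps) pd 2≤pd α²-α≤pd))
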